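{- There exists a proper directed temporal graph $\mathcal{G}=(V,E,\lambda)$ such that there is no simple directed temporal graph $\mathcal{H}$ on $V$, considered with strict temporal paths, that is support equivalent to $\mathcal{G}$. In other words, some graph in the setting D \& proper has no support equivalent graph in the setting D \& strict \& simple.
   Context: A directed temporal graph is a triple $\mathcal{G}=(V,E,\lambda)$ with $V$ a finite vertex set, $E\subseteq\{(u,v)\in V\times V: u\ne v\}$ a set of arcs, and $\lambda\colon E\to 2^{\mathbb{N}}\setminus\{\emptyset\}$ assigning to each arc a nonempty finite set of time labels. $\mathcal{G}$ is simple if $|\lambda(e)|=1$ for all $e$, and proper if no two distinct arcs incident to a common vertex share a time label. A temporal path from $u$ to $v$ is a sequence $(e_1,t_1),\dots,(e_k,t_k)$, $k\ge1$, with $t_i\in\lambda(e_i)$, such that $e_1,\dots,e_k$ form a directed path from $u$ to $v$ in $(V,E)$ (distinct vertices) and $t_1\le\dots\le t_k$; it is strict if $t_1<\dots<t_k$ (in a proper graph every temporal path is strict). In the strict setting only strict temporal paths are considered. Two temporal paths share the same support if they visit the same vertices in the same order. Two temporal graphs on the same vertex set are support equivalent if for every temporal path (in its setting) in either graph there is a temporal path (in its setting) in the other graph with the same support. -}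

module Defs where

open import Data.Nat using (ℕ; _≤_; _<_)
open import Data.Fin using (Fin)
open import Data.List using (List; []; _∷_; length)
open import Data.List.Membership.Propositional using (_∈_)
open import Data.List.Relation.Unary.Unique.Propositional using (Unique)
open import Data.List.Relation.Unary.Linked using (Linked)
open import Data.Product using (Σ; _×_; ∃)
open import Data.Sum using (_⊎_)
open import Data.Unit using (⊤)
open import Data.Empty using (⊥)
open import Relation.Binary.PropositionalEquality using (_≡_)
open import Relation.Nullary using (¬_)

-- The arc set and labelling are given together: labels u v is a finite list
-- representing the label set λ(u,v); (u,v) ∈ E iff labels u v is nonempty
-- (so every arc has a nonempty finite label set).
record TGraph (n : ℕ) : Set where
  field
    labels : Fin n → Fin n → List ℕ
    noLoop : (v : Fin n) → labels v v ≡ []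
open TGraph public

IsArc : {n : ℕ} → TGraph n → Fin n → Fin n → Set
IsArc G u v = ¬ (labels G u v ≡ [])

Simple : {n : ℕ} → TGraph n → Set
Simple {n} G = (u v : Fin n) → (t t′ : ℕ) → t ∈ labels G u v → t′ ∈ labels G u v → t ≡ t′

ShareVertex : {n : ℕ} → Fin n → Fin n → Fin n → Fin n → Set
ShareVertex u v u′ v′ = (u ≡ u′ ⊎ u ≡ v′) ⊎ (v ≡ u′ ⊎ v ≡ v′)

Proper : {n : ℕ} → TGraph n → Set
Proper {n} G = (u v u′ v′ : Fin n) → ¬ ((u ≡ u′) × (v ≡ v′)) → ShareVertex u v u′ v′ →
  (t : ℕ) → t ∈ labels G u v → t ∈ labels G u′ v′ → ⊥

LabelsAlong : {n : ℕ} → TGraph n → List (Fin n) → List ℕ → Set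
LabelsAlong G [] ts = ⊥
LabelsAlong G (u ∷ []) [] = ⊤
LabelsAlong G (u ∷ []) (t ∷ ts) = ⊥
LabelsAlong G (u ∷ v ∷ xs) [] = ⊥
LabelsAlong G (u ∷ v ∷ xs) (t ∷ ts) = (t ∈ labels G u v) × LabelsAlong G (v ∷ xs) ts

-- xs (vertices in order) is the support of a temporal path in G whose
-- consecutive times are related by R (R = _≤_ : non-strict, R = _<_ : strict).
TPathSupport : {n : ℕ} → (ℕ → ℕ → Set) → TGraph n → List (Fin n) → Set
TPathSupport R G xs =
  (2 ≤ length xs) × Unique xs × ∃ (λ ts → LabelsAlong G xs ts × Linked R ts)

SupportEquivalent : {n : ℕ} → (ℕ → ℕ → Set) → TGraph n → (ℕ → ℕ → Set) → TGraph n → Set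
SupportEquivalent {n} R G S H = (xs : List (Fin n)) →
  (TPathSupport R G xs → TPathSupport S H xs) × (TPathSupport S H xs → TPathSupport R G xs)

-- G has arcs A→B labelled 2, B→C labelled 1 and 3, and C→D labelled 2, which is
-- proper because the two arcs sharing label 2 are disjoint. Then A B C (times 2, 3)
-- and B C D (times 1, 2) are temporal paths but A B C D is not, as no label of B→C
-- equals 2. In a simple graph the strict paths A B C and B C D must use the same
-- label on B→C, so they glue to a strict path A B C D.
module Submission where

open import Defs
open import Data.Nat using (ℕ; _≤_; _<_; s≤s; z≤n)
open import Data.Fin using (Fin; zero; suc)
open import Data.Fin.Properties using (_≟_)
open import Data.List using (List; []; _∷_)
open import Data.List.Membership.Propositional using (_∈_)
open import Data.List.Relation.Unary.Any using (here; there)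
open import Data.List.Relation.Unary.Unique.Propositional using (Unique)
open import Data.List.Relation.Unary.Unique.DecPropositional (_≟_ {4}) using (unique?)
open import Data.List.Relation.Unary.Linked using ([-]; _∷_)
open import Data.Product using (Σ; ∃-syntax; _×_; _,_; proj₁; proj₂)
open import Data.Sum using (inj₁; inj₂)
open import Data.Unit using (tt)
open import Data.Empty using (⊥)
open import Relation.Binary.PropositionalEquality using (_≡_; refl; subst)
open import Relation.Nullary using (¬_)
open import Relation.Nullary.Decidable using (from-yes)

module _ {n : ℕ} {R : ℕ → ℕ → Set} {G : TGraph n} {a b c : Fin n} where

  twoHop⁺ : Unique (a ∷ b ∷ c ∷ []) → ∀ {t₁ t₂} →
            t₁ ∈ labels G a b → t₂ ∈ labels G b c → R t₁ t₂ →
            TPathSupport R G (a ∷ b ∷ c ∷ [])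
  twoHop⁺ u m₁ m₂ r = s≤s (s≤s z≤n) , u , _ , (m₁ , m₂ , tt) , r ∷ [-]

  twoHop⁻ : TPathSupport R G (a ∷ b ∷ c ∷ []) →
            ∃[ t₁ ] ∃[ t₂ ] (t₁ ∈ labels G a b × t₂ ∈ labels G b c × R t₁ t₂)
  twoHop⁻ (_ , _ , t₁ ∷ t₂ ∷ [] , (m₁ , m₂ , tt) , r ∷ [-]) = t₁ , t₂ , m₁ , m₂ , r

  threeHop⁺ : ∀ {d} → Unique (a ∷ b ∷ c ∷ d ∷ []) → ∀ {t₁ t₂ t₃} →
              t₁ ∈ labels G a b → t₂ ∈ labels G b c → t₃ ∈ labels G c d →
              R t₁ t₂ → R t₂ t₃ → TPathSupport R G (a ∷ b ∷ c ∷ d ∷ [])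
  threeHop⁺ u m₁ m₂ m₃ r₁ r₂ =
    s≤s (s≤s z≤n) , u , _ , (m₁ , m₂ , m₃ , tt) , r₁ ∷ r₂ ∷ [-]

  threeHop⁻ : ∀ {d} → TPathSupport R G (a ∷ b ∷ c ∷ d ∷ []) →
              ∃[ t₁ ] ∃[ t₂ ] ∃[ t₃ ] (t₁ ∈ labels G a b × t₂ ∈ labels G b c ×
                                       t₃ ∈ labels G c d × R t₁ t₂ × R t₂ t₃)
  threeHop⁻ (_ , _ , t₁ ∷ t₂ ∷ t₃ ∷ [] , (m₁ , m₂ , m₃ , tt) , r₁ ∷ r₂ ∷ [-]) =
    t₁ , t₂ , t₃ , m₁ , m₂ , m₃ , r₁ , r₂

glue-simple : ∀ {n} {H : TGraph n} {a b c d : Fin n} → Simple H →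
              Unique (a ∷ b ∷ c ∷ d ∷ []) →
              TPathSupport _<_ H (a ∷ b ∷ c ∷ []) →
              TPathSupport _<_ H (b ∷ c ∷ d ∷ []) →
              TPathSupport _<_ H (a ∷ b ∷ c ∷ d ∷ [])
glue-simple {b = b} {c} simple u abc bcd
  with twoHop⁻ abc | twoHop⁻ bcd
... | t₁ , t₂ , m₁ , m₂ , t₁<t₂ | s₁ , s₂ , n₁ , n₂ , s₁<s₂ =
  threeHop⁺ u m₁ m₂ n₂ t₁<t₂ (subst (_< s₂) (simple b c s₁ t₂ n₁ m₂) s₁<s₂)

A B C D : Fin 4
A = zero
B = suc zero
C = suc (suc zero)
D = suc (suc (suc zero))

G : TGraph 4
G = record { labels = lab ; noLoop = noLoop′ }
  where
  lab : Fin 4 → Fin 4 → List ℕ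
  lab zero (suc zero) = 2 ∷ []
  lab (suc zero) (suc (suc zero)) = 1 ∷ 3 ∷ []
  lab (suc (suc zero)) (suc (suc (suc zero))) = 2 ∷ []
  lab _ _ = []

  noLoop′ : (v : Fin 4) → lab v v ≡ []
  noLoop′ zero = refl
  noLoop′ (suc zero) = refl
  noLoop′ (suc (suc zero)) = refl
  noLoop′ (suc (suc (suc zero))) = refl

data LabelledArc : Fin 4 → Fin 4 → ℕ → Set where
  AB2 : LabelledArc A B 2
  BC1 : LabelledArc B C 1
  BC3 : LabelledArc B C 3
  CD2 : LabelledArc C D 2

labelledArc : ∀ u v {t} → t ∈ labels G u v → LabelledArc u v t
labelledArc zero (suc zero) (here refl) = AB2
labelledArc zero (suc zero) (there ())
labelledArc zero zero ()
labelledArc zero (suc (suc _)) ()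
labelledArc (suc zero) (suc (suc zero)) (here refl) = BC1
labelledArc (suc zero) (suc (suc zero)) (there (here refl)) = BC3
labelledArc (suc zero) (suc (suc zero)) (there (there ()))
labelledArc (suc zero) zero ()
labelledArc (suc zero) (suc zero) ()
labelledArc (suc zero) (suc (suc (suc _))) ()
labelledArc (suc (suc zero)) (suc (suc (suc zero))) (here refl) = CD2
labelledArc (suc (suc zero)) (suc (suc (suc zero))) (there ())
labelledArc (suc (suc zero)) zero ()
labelledArc (suc (suc zero)) (suc zero) ()
labelledArc (suc (suc zero)) (suc (suc zero)) ()
labelledArc (suc (suc (suc zero))) _ ()

properG : Proper G
properG u v u′ v′ distinct shared t m m′ =
  disjointOrEqual (labelledArc u v m) (labelledArc u′ v′ m′) distinct shared
  where
  disjointOrEqual : ∀ {u v u′ v′ t} → LabelledArc u v t → LabelledArc u′ v′ t →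
                    ¬ ((u ≡ u′) × (v ≡ v′)) → ShareVertex u v u′ v′ → ⊥
  disjointOrEqual AB2 AB2 distinct _ = distinct (refl , refl)
  disjointOrEqual BC1 BC1 distinct _ = distinct (refl , refl)
  disjointOrEqual BC3 BC3 distinct _ = distinct (refl , refl)
  disjointOrEqual CD2 CD2 distinct _ = distinct (refl , refl)
  disjointOrEqual AB2 CD2 _ (inj₁ (inj₁ ()))
  disjointOrEqual AB2 CD2 _ (inj₁ (inj₂ ()))
  disjointOrEqual AB2 CD2 _ (inj₂ (inj₁ ()))
  disjointOrEqual AB2 CD2 _ (inj₂ (inj₂ ()))
  disjointOrEqual CD2 AB2 _ (inj₁ (inj₁ ()))
  disjointOrEqual CD2 AB2 _ (inj₁ (inj₂ ()))
  disjointOrEqual CD2 AB2 _ (inj₂ (inj₁ ()))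
  disjointOrEqual CD2 AB2 _ (inj₂ (inj₂ ()))

unique-ABCD : Unique (A ∷ B ∷ C ∷ D ∷ [])
unique-ABCD = from-yes (unique? (A ∷ B ∷ C ∷ D ∷ []))

path-ABC : TPathSupport _≤_ G (A ∷ B ∷ C ∷ [])
path-ABC = twoHop⁺ (from-yes (unique? (A ∷ B ∷ C ∷ []))) (here refl) (there (here refl)) (s≤s (s≤s z≤n))

path-BCD : TPathSupport _≤_ G (B ∷ C ∷ D ∷ [])
path-BCD = twoHop⁺ (from-yes (unique? (B ∷ C ∷ D ∷ []))) (here refl) (here refl) (s≤s z≤n)

no-path-ABCD : ¬ TPathSupport _≤_ G (A ∷ B ∷ C ∷ D ∷ [])
no-path-ABCD p with threeHop⁻ p
... | _ , _ , _ , m₁ , m₂ , m₃ , r₁ , r₂ =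
  impossible (labelledArc A B m₁) (labelledArc B C m₂) (labelledArc C D m₃) r₁ r₂
  where
  impossible : ∀ {t₁ t₂ t₃} → LabelledArc A B t₁ → LabelledArc B C t₂ →
               LabelledArc C D t₃ → t₁ ≤ t₂ → t₂ ≤ t₃ → ⊥
  impossible AB2 BC1 CD2 (s≤s ()) _
  impossible AB2 BC3 CD2 _ (s≤s (s≤s ()))

lemma12 : Σ ℕ (λ n → Σ (TGraph n) (λ G → Proper G ×
    ¬ Σ (TGraph n) (λ H → Simple H × SupportEquivalent _≤_ G _<_ H)))
lemma12 = 4 , G , properG , λ (H , simple , equiv) →
  let toH   = λ xs → proj₁ (equiv xs)
      fromH = λ xs → proj₂ (equiv xs)
  in no-path-ABCD (fromH _ (glue-simple simple unique-ABCD
                             (toH _ path-ABC) (toH _ path-BCD)))
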